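{- Let $\gamma=(v_0,e_1,v_1,\dots,e_\ell,v_\ell)$ be a driftless loop in $G_n$. Then every cyclic permutation of $\gamma$, i.e. every loop $(v_k,e_{k+1},\dots,e_\ell,v_\ell=v_0,e_1,\dots,e_k,v_k)$ with $0\le k<\ell$, is driftless.
   Context: $[n]=\{1,\dots,n\}$. For distinct reals $y_1,\dots,y_n$, $\mathrm{Order}(y_1,\dots,y_n)$ is the unique $\sigma\in S_n$ with $y_i<y_j$ iff $\sigma(i)<\sigma(j)$. $\rho,\rho':S_{n+1}\to S_n$: $\rho(\sigma)=\mathrm{Order}(\sigma(1),\dots,\sigma(n))$, $\rho'(\sigma)=\mathrm{Order}(\sigma(2),\dots,\sigma(n+1))$. The permutation digraph $G_n$ has vertex set $S_n$ and edge set $S_{n+1}$, edge $e$ directed from $\rho(e)$ to $\rho'(e)$. A path of length $\ell$ is $(v_0,e_1,v_1,\dots,e_\ell,v_\ell)$ with $e_i$ directed from $v_{i-1}$ to $v_i$; a loop is a finite path of length $\ell\ge1$ with $v_\ell=v_0$. For a path $p$ of length $\ell$ let $Q_p=\{x_1,\dots,x_{\ell+n}\}$ with $\le$ the reflexive-transitive closure of: $x_{a+c}\le x_{a+d}$ when $0\le a\le\ell$, $c,d\in[n]$, $v_a(c)\le v_a(d)$; $x_{a-1+c}\le x_{a-1+d}$ when $1\le a\le\ell$, $c,d\in[n+1]$, $e_a(c)\le e_a(d)$. For a loop $\gamma$ of length $\ell$ and $i\in[n]$, $\mathrm{Drift}_\gamma(i)=+$ if $x_i\le x_{\ell+i}$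 in $Q_\gamma$, $-$ if $x_i\ge x_{\ell+i}$, $0$ if incomparable. A loop $\gamma$ is driftless if $\mathrm{Drift}_\gamma(i)=0$ for all $i\in[n]$. -}

module Defs where

open import Data.Nat using (ℕ; zero; suc; _+_; _∸_; _≤_; _<_; NonZero)
open import Data.Nat.DivMod using (_%_)
open import Data.Fin using (Fin; toℕ; inject₁) renaming (suc to fsuc)
open import Data.Fin.Permutation using (Permutation′; _⟨$⟩ʳ_)
open import Data.Product using (_×_; Σ)
open import Relation.Nullary using (¬_)
open import Relation.Binary.PropositionalEquality using (_≡_)
open import Relation.Binary.Construct.Closure.ReflexiveTransitive using (Star)
open import Function.Bundles using (_⇔_)

S : ℕ → Set
S n = Permutation′ n

IsOrder : {n : ℕ} → (Fin n → ℕ) → S n → Set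
IsOrder {n} y σ = (i j : Fin n) → (y i < y j) ⇔ (toℕ (σ ⟨$⟩ʳ i) < toℕ (σ ⟨$⟩ʳ j))

ρ-is : {n : ℕ} → S (suc n) → S n → Set
ρ-is e v = IsOrder (λ c → toℕ (e ⟨$⟩ʳ inject₁ c)) v

ρ'-is : {n : ℕ} → S (suc n) → S n → Set
ρ'-is e w = IsOrder (λ c → toℕ (e ⟨$⟩ʳ fsuc c)) w

-- A path of length ℓ in G_n: vertices v 0 … v ℓ and edges e 1 … e ℓ
-- (values of v, e outside these index ranges are irrelevant).
record Path (n : ℕ) : Set where
  field
    len  : ℕ
    vert : ℕ → S n
    edge : ℕ → S (suc n)
    src  : (a : ℕ) → 1 ≤ a → a ≤ len → ρ-is  (edge a) (vert (a ∸ 1))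
    tgt  : (a : ℕ) → 1 ≤ a → a ≤ len → ρ'-is (edge a) (vert a)
open Path public

record Loop (n : ℕ) : Set where
  field
    path   : Path n
    len≥1  : 1 ≤ len path
    closed : vert path (len path) ≡ vert path 0
open Loop public

-- Element x_j (1-based, j ∈ [1, ℓ+n]) is
-- represented by the natural number j ∸ 1 (0-based).
-- vgen: x_{a+c} ≤ x_{a+d} when 0 ≤ a ≤ ℓ, v_a(c) ≤ v_a(d)   (c,d ∈ [n])
-- egen: x_{a-1+c} ≤ x_{a-1+d} when 1 ≤ a ≤ ℓ, e_a(c) ≤ e_a(d) (c,d ∈ [n+1])
data Gen {n : ℕ} (p : Path n) : ℕ → ℕ → Set where
  vgen : (a : ℕ) → a ≤ len p → (c d : Fin n) →
         toℕ (vert p a ⟨$⟩ʳ c) ≤ toℕ (vert p a ⟨$⟩ʳ d) →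
         Gen p (a + toℕ c) (a + toℕ d)
  egen : (a : ℕ) → 1 ≤ a → a ≤ len p → (c d : Fin (suc n)) →
         toℕ (edge p a ⟨$⟩ʳ c) ≤ toℕ (edge p a ⟨$⟩ʳ d) →
         Gen p ((a ∸ 1) + toℕ c) ((a ∸ 1) + toℕ d)

_≤[_]_ : {n : ℕ} → ℕ → Path n → ℕ → Set
i ≤[ p ] j = Star (Gen p) i j

DriftZero : {n : ℕ} → Loop n → Fin n → Set
DriftZero γ i =
  ¬ (toℕ i ≤[ path γ ] (len (path γ) + toℕ i)) ×
  ¬ ((len (path γ) + toℕ i) ≤[ path γ ] toℕ i)

Driftless : {n : ℕ} → Loop n → Set
Driftless {n} γ = (i : Fin n) → DriftZero γ i

-- The cyclic shift of a loop of length ℓ by k (0 ≤ k < ℓ) as a raw path datum: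
-- new vertices v'_a = v_{(k+a) mod ℓ}, new edges e'_a = e_{((k+a-1) mod ℓ)+1}.
-- (Using v_ℓ = v_0, these agree with (v_k, e_{k+1}, …, e_ℓ, v_ℓ = v_0, e_1, …, e_k, v_k).)
shiftVert : {n : ℕ} (γ : Loop n) → .{{NonZero (len (path γ))}} → ℕ → ℕ → S n
shiftVert γ k a = vert (path γ) ((k + a) % len (path γ))

shiftEdge : {n : ℕ} (γ : Loop n) → .{{NonZero (len (path γ))}} → ℕ → ℕ → S (suc n)
shiftEdge γ k a = edge (path γ) (suc ((k + (a ∸ 1)) % len (path γ)))

IsCyclicShift : {n : ℕ} → Loop n → ℕ → Loop n → Set
IsCyclicShift γ k γ' =
  Σ (NonZero (len (path γ))) λ nz →
    (len (path γ') ≡ len (path γ)) ×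
    ((a : ℕ) → a ≤ len (path γ) → vert (path γ') a ≡ shiftVert γ {{nz}} k a) ×
    ((a : ℕ) → 1 ≤ a → a ≤ len (path γ) → edge (path γ') a ≡ shiftEdge γ {{nz}} k a)

-- Unroll the loop periodically: position w + c (c ≤ n) is seen by the edge e_{(w mod ℓ)+1}, which
-- orders the window w, …, w + n, and two overlapping windows order their common positions alike,
-- since consecutive windows share a vertex of the loop.  A chain of generators of Q_γ′ from x_i
-- to x_{ℓ+i} becomes, after translation by k, a chain in this periodic structure from s = k + i to
-- s + ℓ.  Such a chain can be straightened into an ascent s = q₀ ≤ q₁ ≤ ⋯ ≤ s + ℓ in which each
-- q_{r+1} lies in the window of q_r and above q_r there.  Cutting the ascent at a multiple x of ℓ
-- and gluing the tail to the translate of the head by ℓ gives an ascent from x + j to x + j + ℓ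
-- with j < n; translated back by x it lies within the positions 0, …, ℓ - 1 + n of γ itself and
-- is a chain of Q_γ from x_j to x_{ℓ+j}.  The case x_{ℓ+i} ≤ x_i is the same argument for the
-- opposite orders.

module Submission where

open import Defs
open import Data.Empty using (⊥-elim)
open import Data.Fin using (Fin; toℕ; fromℕ<; inject₁) renaming (suc to fsuc)
open import Data.Fin.Permutation using (_⟨$⟩ʳ_)
open import Data.Fin.Properties
  using (toℕ-fromℕ<; toℕ≤pred[n]; toℕ<n; toℕ-inject₁; fromℕ<-cong; fromℕ<-toℕ)
open import Data.Nat using (ℕ; zero; suc; _+_; _∸_; _*_; _≤_; _<_; z≤n; s≤s; NonZero; pred)
open import Data.Nat.Divisibility using (_∣_; ∣-refl; n∣m*n)
open import Data.Nat.DivMod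
  using (_/_; _%_; _mod_; m≡m%n+[m/n]*n; m%n<n; m/n*n≤m; [m+kn]%n≡m%n; m<n⇒m%n≡m; n%n≡0;
         %-remove-+ˡ)
open import Data.Nat.Properties
open import Algebra.Properties.CommutativeSemigroup +-commutativeSemigroup using (x∙yz≈y∙xz)
open import Data.Product using (Σ; _×_; _,_; proj₁; proj₂)
open import Data.Sum using (inj₁; inj₂)
open import Function.Base using (id; flip)
open import Function.Bundles using (_⇔_; Equivalence; mk⇔)
open import Function.Properties.Equivalence
  using () renaming (refl to ⇔-refl; sym to ⇔-sym; trans to ⇔-trans)
open import Function.Related.Propositional using (≡⇒; equivalence; module EquationalReasoning)
open import Relation.Nullary using (¬_; yes; no)
open import Relation.Binary.PropositionalEquality
open import Relation.Binary.Construct.Closure.ReflexiveTransitive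
  using (Star; ε; _◅_; _◅◅_; gmap; reverse)

Fin-offset : ∀ {m w p} → w ≤ p → p < w + m → Σ (Fin m) λ c → w + toℕ c ≡ p
Fin-offset {m} {w} {p} w≤p p<w+m =
    fromℕ< p∸w<m
  , trans (cong (w +_) (toℕ-fromℕ< p∸w<m)) (m+[n∸m]≡n w≤p)
  where
    p∸w<m : p ∸ w < m
    p∸w<m = +-cancelˡ-< w (p ∸ w) m (subst (_< w + m) (sym (m+[n∸m]≡n w≤p)) p<w+m)

IsOrder-≤ : ∀ {m} (σ : S m) {y : Fin m → ℕ} → IsOrder y σ →
            ∀ c d → y c ≤ y d ⇔ toℕ (σ ⟨$⟩ʳ c) ≤ toℕ (σ ⟨$⟩ʳ d)
IsOrder-≤ σ y≈σ c d = mk⇔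
  (λ y≤ → ≮⇒≥ (λ σ> → ≤⇒≯ y≤ (Equivalence.from (y≈σ d c) σ>)))
  (λ σ≤ → ≮⇒≥ (λ y> → ≤⇒≯ σ≤ (Equivalence.to (y≈σ d c) y>)))

toℕ-mod : ∀ {n} (c : Fin (suc n)) → toℕ c mod suc n ≡ c
toℕ-mod c = trans (fromℕ<-cong _ _ (m<n⇒m%n≡m (toℕ<n c)) _ (toℕ<n c)) (fromℕ<-toℕ c _)

m≤[1+m/n]*n : ∀ m n .{{_ : NonZero n}} → m ≤ suc (m / n) * n
m≤[1+m/n]*n m n =
  ≤-trans (≤-reflexive (m≡m%n+[m/n]*n m n)) (+-monoˡ-≤ (m / n * n) (<⇒≤ (m%n<n m n)))

[1+m/n]*n≤n+m : ∀ m n .{{_ : NonZero n}} → suc (m / n) * n ≤ n + m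
[1+m/n]*n≤n+m m n = +-monoʳ-≤ n (m/n*n≤m m n)

within-mono : ∀ {n w w′ p} → w ≤ w′ → p ≤ w + n → p ≤ w′ + n
within-mono {n} w≤w′ p≤ = ≤-trans p≤ (+-monoˡ-≤ n w≤w′)

-- p ⊑⟨ w ⟩ q compares the positions p and q in the window w, …, w + n and is only meaningful
-- when both lie in it; L is the period.
record WindowedPreorder (n L : ℕ) : Set₁ where
  field
    _⊑⟨_⟩_     : ℕ → ℕ → ℕ → Set
    ⊑-refl     : ∀ {w p} → p ⊑⟨ w ⟩ p
    ⊑-trans    : ∀ {w p q r} → p ⊑⟨ w ⟩ q → q ⊑⟨ w ⟩ r → p ⊑⟨ w ⟩ r
    ⊑-window   : ∀ {w w′ p q} → w ≤ w′ → w′ ≤ p → w′ ≤ q → p ≤ w + n → q ≤ w + n →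
                 p ⊑⟨ w ⟩ q ⇔ p ⊑⟨ w′ ⟩ q
    ⊑-periodic : ∀ {m w p q} → L ∣ m → p ⊑⟨ w ⟩ q ⇔ (m + p) ⊑⟨ m + w ⟩ (m + q)

_ᵒᵖ : ∀ {n L} → WindowedPreorder n L → WindowedPreorder n L
W ᵒᵖ = record
  { _⊑⟨_⟩_     = λ p w q → q ⊑⟨ w ⟩ p
  ; ⊑-refl     = ⊑-refl
  ; ⊑-trans    = flip ⊑-trans
  ; ⊑-window   = λ w≤w′ w′≤p w′≤q p≤ q≤ → ⊑-window w≤w′ w′≤q w′≤p q≤ p≤
  ; ⊑-periodic = ⊑-periodic
  }
  where open WindowedPreorder W

module _ {n L : ℕ} (W : WindowedPreorder n L) where
  open WindowedPreorder W

  record Rise (p q : ℕ) : Set where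
    constructor rise
    field
      rises  : p ≤ q
      within : q ≤ p + n
      below  : p ⊑⟨ p ⟩ q

  record WindowStep (p q : ℕ) : Set where
    constructor step
    field
      {window} : ℕ
      w≤p      : window ≤ p
      w≤q      : window ≤ q
      p≤w+n    : p ≤ window + n
      q≤w+n    : q ≤ window + n
      below    : p ⊑⟨ window ⟩ q

Fall : ∀ {n L} → WindowedPreorder n L → ℕ → ℕ → Set
Fall W = Rise (W ᵒᵖ)

Ascent Descent : ∀ {n L} → WindowedPreorder n L → ℕ → ℕ → Set
Ascent W = Star (Rise W)
Descent W = Star (Fall W)

module Windows {n L : ℕ} (W : WindowedPreorder n L) where
  open WindowedPreorder W

  shift-window : ∀ {w w′ p q} → w ≤ w′ → w′ ≤ p → w′ ≤ q → p ≤ w + n → q ≤ w + n →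
                 p ⊑⟨ w ⟩ q → p ⊑⟨ w′ ⟩ q
  shift-window w≤w′ w′≤p w′≤q p≤ q≤ = Equivalence.to (⊑-window w≤w′ w′≤p w′≤q p≤ q≤)

  unshift-window : ∀ {w w′ p q} → w ≤ w′ → w′ ≤ p → w′ ≤ q → p ≤ w + n → q ≤ w + n →
                   p ⊑⟨ w′ ⟩ q → p ⊑⟨ w ⟩ q
  unshift-window w≤w′ w′≤p w′≤q p≤ q≤ = Equivalence.from (⊑-window w≤w′ w′≤p w′≤q p≤ q≤)

  offset-step : ∀ w (c d : Fin (suc n)) → (w + toℕ c) ⊑⟨ w ⟩ (w + toℕ d) →
                WindowStep W (w + toℕ c) (w + toℕ d)
  offset-step w c d =
    step (m≤m+n w _) (m≤m+n w _) (+-monoʳ-≤ w (toℕ≤pred[n] c)) (+-monoʳ-≤ w (toℕ≤pred[n] d))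

  settle : ∀ {p q} → WindowStep W p q → (p ≤ q → Rise W p q) × (q ≤ p → Fall W q p)
  settle (step w≤p w≤q p≤ q≤ p⊑q) =
      (λ p≤q → rise p≤q (within-mono w≤p q≤) (shift-window w≤p ≤-refl p≤q p≤ q≤ p⊑q))
    , (λ q≤p → rise q≤p (within-mono w≤q p≤) (shift-window w≤q q≤p ≤-refl p≤ q≤ p⊑q))

  valley : ∀ {m s q} → Fall W m s → Rise W m q → WindowStep W s q
  valley (rise m≤s s≤ s⊑m) (rise m≤q q≤ m⊑q) = step m≤s m≤q s≤ q≤ (⊑-trans s⊑m m⊑q)

  peak : ∀ {s m t} → Rise W s m → Fall W t m → WindowStep W s t
  peak {s} {m} {t} (rise s≤m m≤s+n s⊑m) (rise t≤m m≤t+n m⊑t) with ≤-total s t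
  ... | inj₁ s≤t = step ≤-refl s≤t (m≤m+n s n) t≤s+n
        (⊑-trans s⊑m (unshift-window s≤t t≤m ≤-refl m≤s+n t≤s+n m⊑t))
    where t≤s+n = ≤-trans t≤m m≤s+n
  ... | inj₂ t≤s = step t≤s ≤-refl s≤t+n (m≤m+n t n)
        (⊑-trans (unshift-window t≤s ≤-refl s≤m s≤t+n m≤t+n s⊑m) m⊑t)
    where s≤t+n = ≤-trans s≤m m≤t+n

  ascent-≤ : ∀ {a b} → Ascent W a b → a ≤ b
  ascent-≤ ε                = ≤-refl
  ascent-≤ (rise a≤q _ _ ◅ ρs) = ≤-trans a≤q (ascent-≤ ρs)

  rise-trans : ∀ {a q b} → Rise W a q → Rise W q b → b ≤ a + n → Rise W a b
  rise-trans (rise a≤q q≤ a⊑q) (rise q≤b _ q⊑b) b≤ =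
    rise (≤-trans a≤q q≤b) b≤ (⊑-trans a⊑q (unshift-window a≤q ≤-refl q≤b q≤ b≤ q⊑b))

  ascent⇒rise : ∀ {a b} → Ascent W a b → b ≤ a + n → Rise W a b
  ascent⇒rise ε                  _  = rise ≤-refl (m≤m+n _ n) ⊑-refl
  ascent⇒rise (ρ@(rise a≤q _ _) ◅ ρs) b≤ =
    rise-trans ρ (ascent⇒rise ρs (within-mono a≤q b≤)) b≤

  ascent-backtrack : ∀ {m s t} → Fall W m s → Ascent W m t → s ≤ t → Ascent W s t
  ascent-backtrack (rise m≤s _ _) ε s≤m = subst (λ x → Ascent W x _) (≤-antisym m≤s s≤m) ε
  ascent-backtrack {s = s} φ (_◅_ {j = q} ρ ρs) s≤t with q ≤? s
  ... | yes q≤s = ascent-backtrack (proj₂ (settle (valley φ ρ)) q≤s) ρs s≤t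
  ... | no  q≰s = proj₁ (settle (valley φ ρ)) (<⇒≤ (≰⇒> q≰s)) ◅ ρs

  ascent-overshoot : ∀ {a r b} → Ascent W a r → Fall W b r → a ≤ b → Ascent W a b
  ascent-overshoot ε (rise b≤a _ _) a≤b = subst (Ascent W _) (≤-antisym a≤b b≤a) ε
  ascent-overshoot {b = b} (_◅_ {j = q} ρ ρs) φ@(rise _ r≤b+n _) a≤b with q ≤? b
  ... | yes q≤b = ρ ◅ ascent-overshoot ρs φ q≤b
  ... | no  q≰b = proj₁ (settle (peak ρ (proj₂ (settle (peak tail φ)) b≤q))) a≤b ◅ ε
    where
      b≤q = <⇒≤ (≰⇒> q≰b)
      tail = ascent⇒rise ρs (within-mono b≤q r≤b+n)

  ascent-split : 1 ≤ n → ∀ {a b} x → Ascent W a b → a ≤ x → x ≤ b →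
                 Σ ℕ λ c → x ≤ c × c < x + n × Ascent W a c × Ascent W c b
  ascent-split n≥1 {a} x ρs a≤x x≤b with x ≤? a
  ... | yes x≤a = a , x≤a , ≤-<-trans a≤x (m<m+n x n≥1) , ε , ρs
  ascent-split n≥1 x ε                  a≤x x≤a | no x≰a = ⊥-elim (x≰a x≤a)
  ascent-split n≥1 x (_◅_ {j = q} ρ ρs) a≤x x≤b | no x≰a with x ≤? q
  ... | yes x≤q = q , x≤q , ≤-<-trans (Rise.within ρ) (+-monoˡ-< n (≰⇒> x≰a)) , ρ ◅ ε , ρs
  ... | no  x≰q with ascent-split n≥1 x ρs (<⇒≤ (≰⇒> x≰q)) x≤b
  ...   | c , x≤c , c<x+n , ρs₁ , ρs₂ = c , x≤c , c<x+n , ρ ◅ ρs₁ , ρs₂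

  shift-up : ∀ {m a b} → L ∣ m → Ascent W a b → Ascent W (m + a) (m + b)
  shift-up {m} L∣m = gmap (m +_) rise-up
    where
      rise-up : ∀ {a b} → Rise W a b → Rise W (m + a) (m + b)
      rise-up {a} (rise a≤b b≤a+n a⊑b) =
        rise (+-monoʳ-≤ m a≤b)
             (≤-trans (+-monoʳ-≤ m b≤a+n) (≤-reflexive (sym (+-assoc m a n))))
             (Equivalence.to (⊑-periodic L∣m) a⊑b)

  shift-down : ∀ {m a b x y} → L ∣ m → Ascent W x y → x ≡ m + a → y ≡ m + b → Ascent W a b
  shift-down {m} {a} {b} L∣m ε x≡ y≡ = subst (Ascent W a) (+-cancelˡ-≡ m a b (trans (sym x≡) y≡)) ε
  shift-down {m} {a} L∣m (_◅_ {j = q} ρ ρs) refl y≡ =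
    rise-down (subst (Rise W (m + a)) (sym m+q′≡q) ρ) ◅ shift-down L∣m ρs (sym m+q′≡q) y≡
    where
      m+q′≡q : m + (q ∸ m) ≡ q
      m+q′≡q = m+[n∸m]≡n (≤-trans (m≤m+n m a) (Rise.rises ρ))
      rise-down : ∀ {a b} → Rise W (m + a) (m + b) → Rise W a b
      rise-down {a} {b} (rise m+a≤m+b m+b≤ a⊑b) =
        rise (+-cancelˡ-≤ m a b m+a≤m+b)
             (+-cancelˡ-≤ m b (a + n) (≤-trans m+b≤ (≤-reflexive (+-assoc m a n))))
             (Equivalence.from (⊑-periodic L∣m) a⊑b)

  rotate-at : 1 ≤ n → ∀ {s} x → L ∣ x → s ≤ x → x ≤ L + s → Ascent W s (L + s) →
              Σ (Fin n) λ j → Ascent W (toℕ j) (L + toℕ j)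
  rotate-at n≥1 x L∣x s≤x x≤L+s ρs with ascent-split n≥1 x ρs s≤x x≤L+s
  ... | c , x≤c , c<x+n , ρs₁ , ρs₂ with Fin-offset x≤c c<x+n
  ... | j , refl = j , shift-down L∣x (ρs₂ ◅◅ shift-up ∣-refl ρs₁) refl (x∙yz≈y∙xz L x (toℕ j))

  rotate : {{_ : NonZero L}} → 1 ≤ n → ∀ {s} → Ascent W s (L + s) →
           Σ (Fin n) λ j → Ascent W (toℕ j) (L + toℕ j)
  rotate n≥1 {s} =
    rotate-at n≥1 (suc (s / L) * L) (n∣m*n (suc (s / L))) (m≤[1+m/n]*n s L) ([1+m/n]*n≤n+m s L)

  ascent⇒Star : ∀ {R : ℕ → ℕ → Set} {bound} → (∀ {p q} → Rise W p q → q ≤ bound → R p q) →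
                ∀ {a b} → Ascent W a b → b ≤ bound → Star R a b
  ascent⇒Star rise⇒R ε        _  = ε
  ascent⇒Star rise⇒R (ρ ◅ ρs) b≤ = rise⇒R ρ (≤-trans (ascent-≤ ρs) b≤) ◅ ascent⇒Star rise⇒R ρs b≤

flip-step : ∀ {n L} {W : WindowedPreorder n L} {p q} → WindowStep W q p → WindowStep (W ᵒᵖ) p q
flip-step (step w≤q w≤p q≤ p≤ q⊑p) = step w≤p w≤q p≤ q≤ q⊑p

module Chains {n L : ℕ} (W : WindowedPreorder n L) where
  open Windows W
  private module D = Windows (W ᵒᵖ)

  Monotone : ℕ → ℕ → Set
  Monotone s t = (s ≤ t → Ascent W s t) × (t ≤ s → Descent W t s)

  prepend-ascent : ∀ {s m t} → WindowStep W s m → Monotone m t → s ≤ t → Ascent W s t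
  prepend-ascent {s} {m} {t} σ (ascent , descent) s≤t with s ≤? m
  ... | no s≰m = ascent-backtrack (proj₂ (settle σ) m≤s) (ascent (≤-trans m≤s s≤t)) s≤t
    where m≤s = <⇒≤ (≰⇒> s≰m)
  ... | yes s≤m with m ≤? t
  ...   | yes m≤t = proj₁ (settle σ) s≤m ◅ ascent m≤t
  ...   | no  m≰t = proj₁ (settle (peak ρ φ)) s≤t ◅ ε
    where
      ρ = proj₁ (settle σ) s≤m
      φ = D.ascent⇒rise (descent (<⇒≤ (≰⇒> m≰t))) (within-mono s≤t (Rise.within ρ))

  prepend-descent : ∀ {s m t} → WindowStep W s m → Monotone m t → t ≤ s → Descent W t s
  prepend-descent {s} {m} {t} σ (ascent , descent) t≤s with m ≤? s
  ... | no m≰s = D.ascent-overshoot (descent (≤-trans t≤s s≤m)) (proj₁ (settle σ) s≤m) t≤s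
    where s≤m = <⇒≤ (≰⇒> m≰s)
  ... | yes m≤s with t ≤? m
  ...   | yes t≤m = descent t≤m ◅◅ (proj₂ (settle σ) m≤s ◅ ε)
  ...   | no  t≰m = proj₂ (settle (valley φ ρ)) t≤s ◅ ε
    where
      φ = proj₂ (settle σ) m≤s
      ρ = ascent⇒rise (ascent (<⇒≤ (≰⇒> t≰m))) (≤-trans t≤s (Rise.within φ))

  steps⇒monotone : ∀ {s t} → Star (WindowStep W) s t → Monotone s t
  steps⇒monotone ε        = (λ _ → ε) , (λ _ → ε)
  steps⇒monotone (σ ◅ σs) = prepend-ascent σ ih , prepend-descent σ ih
    where ih = steps⇒monotone σs

  rotate-chain : {{_ : NonZero L}} → 1 ≤ n → ∀ {R : ℕ → ℕ → Set} →
                 (∀ {p q} → Rise W p q → q ≤ pred L + n → R p q) →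
                 ∀ {s} → Star (WindowStep W) s (L + s) → Σ (Fin n) λ j → Star R (toℕ j) (L + toℕ j)
  rotate-chain n≥1 rise⇒R σs with rotate n≥1 (proj₁ (steps⇒monotone σs) (m≤n+m _ L))
  ... | j , ρs = j , ascent⇒Star rise⇒R ρs L+j≤
    where
      L+j≤ : L + toℕ j ≤ pred L + n
      L+j≤ = begin
        L + toℕ j          ≡⟨ cong (_+ toℕ j) (sym (suc-pred L)) ⟩
        suc (pred L + toℕ j) ≡⟨ sym (+-suc (pred L) (toℕ j)) ⟩
        pred L + suc (toℕ j) ≤⟨ +-monoʳ-≤ (pred L) (toℕ<n j) ⟩
        pred L + n         ∎
        where open ≤-Reasoning

module LoopWindows {n : ℕ} (γ : Loop n) {{_ : NonZero (len (path γ))}} where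
  P : Path n
  P = path γ

  L : ℕ
  L = len P

  -- The window w is ordered by the edge e_{(w mod ℓ)+1}; offsets beyond n are reduced modulo
  -- n + 1, but such junk values are never used.
  edgeAt : ℕ → S (suc n)
  edgeAt w = edge P (suc (w % L))

  rank : ℕ → ℕ → ℕ
  rank w p = toℕ (edgeAt w ⟨$⟩ʳ ((p ∸ w) mod suc n))

  _⊑⟨_⟩_ : ℕ → ℕ → ℕ → Set
  p ⊑⟨ w ⟩ q = rank w p ≤ rank w q

  rank-at : ∀ w (c : Fin (suc n)) → rank w (w + toℕ c) ≡ toℕ (edgeAt w ⟨$⟩ʳ c)
  rank-at w c = cong (λ o → toℕ (edgeAt w ⟨$⟩ʳ o))
                     (trans (cong (_mod suc n) (m+n∸m≡n w (toℕ c))) (toℕ-mod c))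

  ⊑-at : ∀ w (c d : Fin (suc n)) →
         (w + toℕ c) ⊑⟨ w ⟩ (w + toℕ d) ⇔ toℕ (edgeAt w ⟨$⟩ʳ c) ≤ toℕ (edgeAt w ⟨$⟩ʳ d)
  ⊑-at w c d = ≡⇒ (cong₂ _≤_ (rank-at w c) (rank-at w d))

  vert-mod : ∀ {x} → x ≤ L → vert P x ≡ vert P (x % L)
  vert-mod x≤L with m≤n⇒m<n∨m≡n x≤L
  ... | inj₁ x<L = cong (vert P) (sym (m<n⇒m%n≡m x<L))
  ... | inj₂ refl = trans (closed γ) (cong (vert P) (sym (n%n≡0 L)))

  suc-mod : ∀ w → suc w % L ≡ suc (w % L) % L
  suc-mod w =
    trans (cong (λ z → suc z % L) (m≡m%n+[m/n]*n w L)) ([m+kn]%n≡m%n (suc (w % L)) (w / L) L)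

  vert-suc-mod : ∀ w → vert P (suc (w % L)) ≡ vert P (suc w % L)
  vert-suc-mod w = trans (vert-mod (m%n<n w L)) (cong (vert P) (sym (suc-mod w)))

  adjacent-windows : ∀ w (c d : Fin n) →
                     (suc w + toℕ c) ⊑⟨ w ⟩ (suc w + toℕ d) ⇔
                     (suc w + toℕ c) ⊑⟨ suc w ⟩ (suc w + toℕ d)
  adjacent-windows w c d = begin
    (suc w + toℕ c) ⊑⟨ w ⟩ (suc w + toℕ d)
      ≡⟨ cong₂ (λ p q → p ⊑⟨ w ⟩ q) (sym (+-suc w (toℕ c))) (sym (+-suc w (toℕ d))) ⟩
    (w + toℕ (fsuc c)) ⊑⟨ w ⟩ (w + toℕ (fsuc d))
      ∼⟨ ⊑-at w (fsuc c) (fsuc d) ⟩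
    toℕ (edgeAt w ⟨$⟩ʳ fsuc c) ≤ toℕ (edgeAt w ⟨$⟩ʳ fsuc d)
      ∼⟨ IsOrder-≤ (vert P (suc (w % L))) (tgt P (suc (w % L)) (s≤s z≤n) (m%n<n w L)) c d ⟩
    toℕ (vert P (suc (w % L)) ⟨$⟩ʳ c) ≤ toℕ (vert P (suc (w % L)) ⟨$⟩ʳ d)
      ≡⟨ cong (λ v → toℕ (v ⟨$⟩ʳ c) ≤ toℕ (v ⟨$⟩ʳ d)) (vert-suc-mod w) ⟩
    toℕ (vert P (suc w % L) ⟨$⟩ʳ c) ≤ toℕ (vert P (suc w % L) ⟨$⟩ʳ d)
      ∼⟨ ⇔-sym (IsOrder-≤ (vert P (suc w % L))
                            (src P (suc (suc w % L)) (s≤s z≤n) (m%n<n (suc w) L)) c d) ⟩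
    toℕ (edgeAt (suc w) ⟨$⟩ʳ inject₁ c) ≤ toℕ (edgeAt (suc w) ⟨$⟩ʳ inject₁ d)
      ∼⟨ ⇔-sym (⊑-at (suc w) (inject₁ c) (inject₁ d)) ⟩
    (suc w + toℕ (inject₁ c)) ⊑⟨ suc w ⟩ (suc w + toℕ (inject₁ d))
      ≡⟨ cong₂ (λ p q → (suc w + p) ⊑⟨ suc w ⟩ (suc w + q)) (toℕ-inject₁ c) (toℕ-inject₁ d) ⟩
    (suc w + toℕ c) ⊑⟨ suc w ⟩ (suc w + toℕ d) ∎
    where open EquationalReasoning {k = equivalence}

  ⊑-window-suc : ∀ {w p q} → suc w ≤ p → suc w ≤ q → p ≤ w + n → q ≤ w + n →
                 p ⊑⟨ w ⟩ q ⇔ p ⊑⟨ suc w ⟩ q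
  ⊑-window-suc {w} w<p w<q p≤ q≤ with Fin-offset {n} w<p (s≤s p≤) | Fin-offset {n} w<q (s≤s q≤)
  ... | c , refl | d , refl = adjacent-windows w c d

  ⊑-window : ∀ {w w′ p q} → w ≤ w′ → w′ ≤ p → w′ ≤ q → p ≤ w + n → q ≤ w + n →
             p ⊑⟨ w ⟩ q ⇔ p ⊑⟨ w′ ⟩ q
  ⊑-window w≤w′ w′≤p w′≤q p≤ q≤ with m≤n⇒m<n∨m≡n w≤w′
  ... | inj₂ refl = ⇔-refl
  ⊑-window {w′ = suc w″} _ w′≤p w′≤q p≤ q≤ | inj₁ (s≤s w≤w″) =
    ⇔-trans (⊑-window w≤w″ (<⇒≤ w′≤p) (<⇒≤ w′≤q) p≤ q≤)
            (⊑-window-suc w′≤p w′≤q (within-mono w≤w″ p≤) (within-mono w≤w″ q≤))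

  ⊑-periodic : ∀ {m w p q} → L ∣ m → p ⊑⟨ w ⟩ q ⇔ (m + p) ⊑⟨ m + w ⟩ (m + q)
  ⊑-periodic {m} {w} {p} {q} L∣m = ⇔-sym (≡⇒ (cong₂ _≤_ (rank-periodic p) (rank-periodic q)))
    where
      rank-periodic : ∀ x → rank (m + w) (m + x) ≡ rank w x
      rank-periodic x = cong₂ (λ e o → toℕ (edge P (suc e) ⟨$⟩ʳ (o mod suc n)))
                              (%-remove-+ˡ w L∣m) ([m+n]∸[m+o]≡n∸o m x w)

  windows : WindowedPreorder n L
  windows = record
    { _⊑⟨_⟩_     = _⊑⟨_⟩_
    ; ⊑-refl     = ≤-refl
    ; ⊑-trans    = ≤-trans
    ; ⊑-window   = ⊑-window
    ; ⊑-periodic = ⊑-periodic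
    }

  open Windows windows using (unshift-window)

  window-offset : ∀ {w p} → w ≤ p → p ≤ w + n → Σ (Fin (suc n)) λ c → w + toℕ c ≡ p
  window-offset {w} w≤p p≤ = Fin-offset w≤p (≤-trans (s≤s p≤) (≤-reflexive (sym (+-suc w n))))

  window⇒Gen : ∀ {w p q} → w < L → w ≤ p → w ≤ q → p ≤ w + n → q ≤ w + n → p ⊑⟨ w ⟩ q → Gen P p q
  window⇒Gen {w} w<L w≤p w≤q p≤ q≤ p⊑q with window-offset w≤p p≤ | window-offset w≤q q≤
  ... | c , refl | d , refl =
    egen (suc w) (s≤s z≤n) w<L c d
      (subst (λ e → toℕ (edge P (suc e) ⟨$⟩ʳ c) ≤ toℕ (edge P (suc e) ⟨$⟩ʳ d)) (m<n⇒m%n≡m w<L)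
             (Equivalence.to (⊑-at w c d) p⊑q))

  ⊑⇒Gen : ∀ {w p q} → w ≤ p → w ≤ q → p ≤ w + n → q ≤ w + n → p ≤ pred L + n → q ≤ pred L + n →
          p ⊑⟨ w ⟩ q → Gen P p q
  ⊑⇒Gen {w} w≤p w≤q p≤ q≤ p≤end q≤end p⊑q with w ≤? pred L
  ... | yes w≤ℓ = window⇒Gen (≤-trans (s≤s w≤ℓ) (≤-reflexive (suc-pred L))) w≤p w≤q p≤ q≤ p⊑q
  ... | no  w≰ℓ = window⇒Gen (≤-reflexive (suc-pred L)) (≤-trans ℓ≤w w≤p) (≤-trans ℓ≤w w≤q)
                             p≤end q≤end (unshift-window ℓ≤w w≤p w≤q p≤end q≤end p⊑q)
    where ℓ≤w = <⇒≤ (≰⇒> w≰ℓ)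

  rise⇒Gen : ∀ {p q} → Rise windows p q → q ≤ pred L + n → Gen P p q
  rise⇒Gen (rise p≤q q≤ p⊑q) q≤end = ⊑⇒Gen ≤-refl p≤q (m≤m+n _ n) q≤ (≤-trans p≤q q≤end) q≤end p⊑q

  fall⇒Gen : ∀ {p q} → Fall windows p q → q ≤ pred L + n → Gen P q p
  fall⇒Gen (rise p≤q q≤ q⊑p) q≤end = ⊑⇒Gen p≤q ≤-refl q≤ (m≤m+n _ n) q≤end (≤-trans p≤q q≤end) q⊑p

module CyclicShift {n : ℕ} (γ : Loop n) {{_ : NonZero (len (path γ))}} (k : ℕ) (γ′ : Loop n)
  (len≡ : len (path γ′) ≡ len (path γ))
  (edges : ∀ a → 1 ≤ a → a ≤ len (path γ) → edge (path γ′) a ≡ shiftEdge γ k a) where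
  open LoopWindows γ
  open Windows windows using (offset-step)

  P′ : Path n
  P′ = path γ′

  shifted-edge-step : ∀ a → 1 ≤ a → a ≤ len P′ → (c d : Fin (suc n)) →
                      toℕ (edge P′ a ⟨$⟩ʳ c) ≤ toℕ (edge P′ a ⟨$⟩ʳ d) →
                      WindowStep windows (k + (a ∸ 1 + toℕ c)) (k + (a ∸ 1 + toℕ d))
  shifted-edge-step a 1≤a a≤ c d c≤d =
    subst₂ (WindowStep windows) (+-assoc k (a ∸ 1) (toℕ c)) (+-assoc k (a ∸ 1) (toℕ d))
      (offset-step (k + (a ∸ 1)) c d (Equivalence.from (⊑-at (k + (a ∸ 1)) c d)
        (subst (λ e → toℕ (e ⟨$⟩ʳ c) ≤ toℕ (e ⟨$⟩ʳ d)) (edges a 1≤a (subst (a ≤_) len≡ a≤)) c≤d)))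

  shifted-step : ∀ {x y} → Gen P′ x y → WindowStep windows (k + x) (k + y)
  shifted-step (egen a 1≤a a≤ c d c≤d) = shifted-edge-step a 1≤a a≤ c d c≤d
  shifted-step (vgen zero _ c d c≤d) =
    subst₂ (λ x y → WindowStep windows (k + x) (k + y)) (toℕ-inject₁ c) (toℕ-inject₁ d)
      (shifted-edge-step 1 ≤-refl (len≥1 γ′) (inject₁ c) (inject₁ d)
        (Equivalence.from (IsOrder-≤ (vert P′ 0) (src P′ 1 ≤-refl (len≥1 γ′)) c d) c≤d))
  shifted-step (vgen (suc a) a<ℓ c d c≤d) =
    subst₂ (λ x y → WindowStep windows (k + x) (k + y)) (+-suc a (toℕ c)) (+-suc a (toℕ d))
      (shifted-edge-step (suc a) (s≤s z≤n) a<ℓ (fsuc c) (fsuc d)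
        (Equivalence.from (IsOrder-≤ (vert P′ (suc a)) (tgt P′ (suc a) (s≤s z≤n) a<ℓ) c d) c≤d))

lemma4p7 : {n : ℕ} (γ : Loop n) → Driftless γ →
    (k : ℕ) → k < len (path γ) →
    (γ' : Loop n) → IsCyclicShift γ k γ' → Driftless γ'
lemma4p7 {n} γ driftless k _ γ′ (ℓ≢0 , len≡ , _ , edges) i = no-rise , no-fall
  where
    instance _ = ℓ≢0
    open LoopWindows γ
    open CyclicShift γ k γ′ len≡ edges

    n≥1 : 1 ≤ n
    n≥1 = ≤-trans (s≤s z≤n) (toℕ<n i)

    lift : ∀ {x y} → Star (Gen P′) x y → Star (WindowStep windows) (k + x) (k + y)
    lift = gmap (k +_) shifted-step

    ends : k + (len P′ + toℕ i) ≡ L + (k + toℕ i)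
    ends = subst (λ ℓ′ → k + (ℓ′ + toℕ i) ≡ L + (k + toℕ i)) (sym len≡) (x∙yz≈y∙xz k L (toℕ i))

    no-rise : ¬ (toℕ i ≤[ P′ ] (len P′ + toℕ i))
    no-rise chain =
      let j , chain′ = Chains.rotate-chain windows n≥1 rise⇒Gen (subst (Star _ _) ends (lift chain))
      in  proj₁ (driftless j) chain′

    no-fall : ¬ ((len P′ + toℕ i) ≤[ P′ ] toℕ i)
    no-fall chain =
      let j , chain′ = Chains.rotate-chain (windows ᵒᵖ) n≥1 fall⇒Gen
                         (subst (Star _ _) ends (reverse flip-step (lift chain)))
      in  proj₂ (driftless j) (reverse id chain′)
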